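{- Let $\omega$ be a real number with $\omega^2+\omega-1=0$. Let $h\ge1$ and let $H(h)$ be the half graph with color classes $\{u_1,\ldots,u_h\}$ and $\{v_1,\ldots,v_h\}$, where $u_i$ is adjacent to $v_j$ if and only if $j\le h-i+1$. Let $(b_1,\ldots,b_{10})=(\omega,-1,0,1,-\omega,-\omega,1,0,-1,\omega)$ and define $x_i=b_s$ whenever $i\equiv s\pmod{10}$, $1\le s\le 10$, for $i=1,\dots,h$. Let $\mathbf{y}$ be the vector on $V(H(h))$ given by $\mathbf{y}(u_i)=\mathbf{y}(v_i)=x_i$ for $i=1,\ldots,h$. Then $\mathbf{y}$ is an eigenvector of the adjacency matrix of $H(h)$ for the eigenvalue $\omega$ if $h\equiv 7\pmod{10}$, and for the eigenvalue $-\omega$ if $h\equiv 2\pmod{10}$.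
   Context: The half graph $H(h)$ is the chain graph with all cells of size one, i.e. the bipartite graph described in the claim; its eigenvalues and eigenvectors are those of its adjacency matrix. -}

module Defs where

open import Level using (Level)
open import Algebra.Bundles using (CommutativeRing)
open import Data.Nat using (ℕ; suc; _<_; _<ᵇ_; _%_) renaming (_+_ to _+ℕ_)
open import Data.Fin using (Fin; toℕ; zero; suc; fromℕ<)
open import Data.Nat.DivMod using (m%n<n)
open import Data.Sum using (_⊎_; inj₁; inj₂)
open import Data.Bool using (Bool; true; false; if_then_else_)
open import Data.Product using (_×_; Σ)
open import Relation.Nullary using (¬_)
import Algebra.Definitions.RawMonoid as RM

-- Everything is stated over an arbitrary commutative ring R (the reals being
-- the intended instance).
module Over {c ℓ : Level} (R : CommutativeRing c ℓ) where
  open CommutativeRing R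

  -- Vertices of the half graph H(h): inj₁ i is u_{i+1}, inj₂ j is v_{j+1}
  -- (0-indexed Fin h encodes indices 1..h).
  Vertex : ℕ → Set
  Vertex h = Fin h ⊎ Fin h

  -- u_i ~ v_j  iff  j ≤ h - i + 1  (1-indexed), i.e. toℕ i + toℕ j < h (0-indexed).
  adjacent : (h : ℕ) → Vertex h → Vertex h → Bool
  adjacent h (inj₁ i) (inj₂ j) = (toℕ i +ℕ toℕ j) <ᵇ h
  adjacent h (inj₂ j) (inj₁ i) = (toℕ i +ℕ toℕ j) <ᵇ h
  adjacent h (inj₁ _) (inj₁ _) = false
  adjacent h (inj₂ _) (inj₂ _) = false

  adjMatrix : (h : ℕ) → Vertex h → Vertex h → Carrier
  adjMatrix h a b = if adjacent h a b then 1# else 0#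

  sumV : (h : ℕ) → (Vertex h → Carrier) → Carrier
  sumV h f = RM.sum +-rawMonoid (λ i → f (inj₁ i)) + RM.sum +-rawMonoid (λ j → f (inj₂ j))

  mulVec : (h : ℕ) → (Vertex h → Vertex h → Carrier) → (Vertex h → Carrier) → Vertex h → Carrier
  mulVec h M y a = sumV h (λ b → M a b * y b)

  IsEigenvector : (h : ℕ) → (Vertex h → Vertex h → Carrier) → (Vertex h → Carrier) → Carrier → Set ℓ
  IsEigenvector h M y λ′ = (∀ a → mulVec h M y a ≈ λ′ * y a) × Σ (Vertex h) (λ a → ¬ (y a ≈ 0#))

  bseq : Carrier → Fin 10 → Carrier
  bseq ω zero = ω
  bseq ω (suc zero) = - 1#
  bseq ω (suc (suc zero)) = 0#
  bseq ω (suc (suc (suc zero))) = 1#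
  bseq ω (suc (suc (suc (suc zero)))) = - ω
  bseq ω (suc (suc (suc (suc (suc zero))))) = - ω
  bseq ω (suc (suc (suc (suc (suc (suc zero)))))) = 1#
  bseq ω (suc (suc (suc (suc (suc (suc (suc zero))))))) = 0#
  bseq ω (suc (suc (suc (suc (suc (suc (suc (suc zero)))))))) = - 1#
  bseq ω (suc (suc (suc (suc (suc (suc (suc (suc (suc zero))))))))) = ω

  -- x_i = b_s with i ≡ s (mod 10), 1 ≤ s ≤ 10; for 0-indexed k (i = k+1), s - 1 = k mod 10
  xseq : Carrier → ℕ → Carrier
  xseq ω k = bseq ω (fromℕ< (m%n<n k 10))

  yvec : (h : ℕ) → Carrier → Vertex h → Carrier
  yvec h ω (inj₁ i) = xseq ω (toℕ i)
  yvec h ω (inj₂ i) = xseq ω (toℕ i)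

module Submission where

-- Both u_i and v_i see exactly the first h − i + 1 vertices of the other side, so both
-- coordinates of A y at position i equal the prefix sum S(h − i + 1) = x_1 + ⋯ + x_{h−i+1}.
-- The sequence x has period 10 and sums to 0 over a period, hence S(k) depends only on
-- k mod 10, and the eigen-equation S(h − i + 1) = λ x_i depends only on the residues of
-- h and i. For h ≡ 7 it reduces to the ten identities S(k) = ω b_{8−k} (indices mod 10),
-- which follow from ω² = 1 − ω; the case h ≡ 2 follows from it since x_{i+5} = −x_i.

open import Defs
open import Level using (Level)
open import Algebra.Bundles using (CommutativeRing)
open import Data.Nat using (ℕ; _%_)
open import Data.Product using (_×_)
open import Relation.Nullary using (¬_)
open import Relation.Binary.PropositionalEquality using (_≡_)

open import Data.Bool using (Bool; if_then_else_)
open import Data.Fin using (Fin; toℕ)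
open import Data.Fin.Patterns
open import Data.Fin.Properties using (toℕ<n; toℕ-fromℕ<; fromℕ<-cong)
open import Data.Nat using (zero; suc; _∸_; _≤_; _<ᵇ_; s≤s; NonZero)
  renaming (_+_ to _+ℕ_; _*_ to _*ℕ_)
open import Data.Nat.DivMod
import Data.Nat.Properties as ℕ
open import Data.Product using (_,_)
open import Data.Sum using (inj₁; inj₂)
open import Function using (_∘_)
import Relation.Binary.PropositionalEquality as ≡
import Algebra.Definitions.RawMonoid as RawMonoid
import Algebra.Properties.Ring as RingProperties

+-cong-% : ∀ m m′ n n′ p .{{_ : NonZero p}} →
           m % p ≡ m′ % p → n % p ≡ n′ % p → (m +ℕ n) % p ≡ (m′ +ℕ n′) % p
+-cong-% m m′ n n′ p m≡m′ n≡n′ = begin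
  (m +ℕ n) % p           ≡⟨ %-distribˡ-+ m n p ⟩
  (m % p +ℕ n % p) % p   ≡⟨ ≡.cong₂ (λ a b → (a +ℕ b) % p) m≡m′ n≡n′ ⟩
  (m′ % p +ℕ n′ % p) % p ≡⟨ %-distribˡ-+ m′ n′ p ⟨
  (m′ +ℕ n′) % p         ∎
  where open ≡.≡-Reasoning

%-cancelʳ-+ : ∀ o {m n} p .{{_ : NonZero p}} → (m +ℕ o) % p ≡ (n +ℕ o) % p → m % p ≡ n % p
%-cancelʳ-+ o {m} {n} p@(suc p′) m+o≡n+o = begin
  m % p                        ≡⟨ [m+kn]%n≡m%n m o p ⟨
  (m +ℕ o *ℕ p) % p            ≡⟨ ≡.cong (_% p) (pad m) ⟩
  (m +ℕ o +ℕ p′ *ℕ o) % p      ≡⟨ +-cong-% (m +ℕ o) (n +ℕ o) (p′ *ℕ o) (p′ *ℕ o) p m+o≡n+o ≡.refl ⟩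
  (n +ℕ o +ℕ p′ *ℕ o) % p      ≡⟨ ≡.cong (_% p) (pad n) ⟨
  (n +ℕ o *ℕ p) % p            ≡⟨ [m+kn]%n≡m%n n o p ⟩
  n % p                        ∎
  where
  open ≡.≡-Reasoning
  pad : ∀ m → m +ℕ o *ℕ p ≡ m +ℕ o +ℕ p′ *ℕ o
  pad m = ≡.trans (≡.cong (m +ℕ_) (ℕ.*-comm o p)) (≡.sym (ℕ.+-assoc m o (p′ *ℕ o)))

[t+p∸k%p]%p≡i%p : ∀ i k t p .{{_ : NonZero p}} → (i +ℕ k) % p ≡ t % p → (t +ℕ p ∸ k % p) % p ≡ i % p
[t+p∸k%p]%p≡i%p i k t p i+k≡t = %-cancelʳ-+ k p (begin
  (t +ℕ p ∸ k % p +ℕ k) % p       ≡⟨ +-cong-% _ _ (k % p) k p ≡.refl (m%n%n≡m%n k p) ⟨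
  (t +ℕ p ∸ k % p +ℕ k % p) % p   ≡⟨ ≡.cong (_% p) (ℕ.m∸n+n≡m k%p≤t+p) ⟩
  (t +ℕ p) % p                    ≡⟨ [m+n]%n≡m%n t p ⟩
  t % p                           ≡⟨ i+k≡t ⟨
  (i +ℕ k) % p                    ∎)
  where
  open ≡.≡-Reasoning
  k%p≤t+p : k % p ≤ t +ℕ p
  k%p≤t+p = ℕ.≤-trans (ℕ.<⇒≤ (m%n<n k p)) (ℕ.m≤n+m p t)

mod-cong : ∀ m n p .{{_ : NonZero p}} → m % p ≡ n % p → m mod p ≡ n mod p
mod-cong m n p m≡n = fromℕ<-cong _ _ m≡n _ _

toℕ-mod : ∀ m p .{{_ : NonZero p}} → toℕ (m mod p) ≡ m % p
toℕ-mod m p = toℕ-fromℕ< _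

module HalfGraphEigenvector {c ℓ : Level} (R : CommutativeRing c ℓ) where
  open CommutativeRing R hiding (zero)
  open Over R
  open RingProperties ring
    using (-‿distribˡ-*; -‿distribʳ-*; -‿involutive; -0#≈0#; ⁻¹-anti-homo‿-;
           x∙y⁻¹≈ε⇒x≈y; x≈z//y; //-rightDividesˡ; //-rightDividesʳ)
  open import Relation.Binary.Reasoning.Setoid setoid

  Σ< : ℕ → (ℕ → Carrier) → Carrier
  Σ< zero    g = 0#
  Σ< (suc n) g = g 0 + Σ< n (g ∘ suc)

  sum≡Σ< : ∀ n (g : ℕ → Carrier) → RawMonoid.sum +-rawMonoid {n} (g ∘ toℕ) ≡ Σ< n g
  sum≡Σ< zero    g = ≡.refl
  sum≡Σ< (suc n) g = ≡.cong (g 0 +_) (sum≡Σ< n (g ∘ suc))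

  Σ<-cong : ∀ n {f g : ℕ → Carrier} → (∀ j → f j ≈ g j) → Σ< n f ≈ Σ< n g
  Σ<-cong zero    f≈g = refl
  Σ<-cong (suc n) f≈g = +-cong (f≈g 0) (Σ<-cong n (f≈g ∘ suc))

  Σ<-zero : ∀ n (g : ℕ → Carrier) → (∀ j → g j ≈ 0#) → Σ< n g ≈ 0#
  Σ<-zero zero    g g≈0 = refl
  Σ<-zero (suc n) g g≈0 = trans (+-cong (g≈0 0) (Σ<-zero n (g ∘ suc) (g≈0 ∘ suc))) (+-identityˡ 0#)

  Σ<-+ : ∀ m n (g : ℕ → Carrier) → Σ< (m +ℕ n) g ≈ Σ< m g + Σ< n (λ j → g (m +ℕ j))
  Σ<-+ zero    n g = sym (+-identityˡ _)
  Σ<-+ (suc m) n g = trans (+-congˡ (Σ<-+ m n (g ∘ suc))) (sym (+-assoc _ _ _))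

  Σ<-snoc : ∀ n (g : ℕ → Carrier) → Σ< (suc n) g ≈ Σ< n g + g n
  Σ<-snoc zero    g = trans (+-identityʳ (g 0)) (sym (+-identityˡ (g 0)))
  Σ<-snoc (suc n) g = trans (+-congˡ (Σ<-snoc n (g ∘ suc))) (sym (+-assoc _ _ _))

  indicator : Bool → Carrier
  indicator b = if b then 1# else 0#

  Σ<-indicator : ∀ {k n} → k ≤ n → (g : ℕ → Carrier) →
                 Σ< n (λ j → indicator (j <ᵇ k) * g j) ≈ Σ< k g
  Σ<-indicator {zero}  {n}     _         g = Σ<-zero n _ (λ j → zeroˡ (g j))
  Σ<-indicator {suc k} {suc n} (s≤s k≤n) g =
    +-cong (*-identityˡ (g 0)) (Σ<-indicator k≤n (g ∘ suc))

  Σ<-periodic : ∀ p .{{_ : NonZero p}} (g : ℕ → Carrier) →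
                (∀ j → g (p +ℕ j) ≡ g j) → Σ< p g ≈ 0# → ∀ k → Σ< k g ≈ Σ< (k % p) g
  Σ<-periodic p g periodic period≈0 k = begin
    Σ< k g                    ≡⟨ ≡.cong (λ m → Σ< m g) k≡q*p+r ⟩
    Σ< (k / p *ℕ p +ℕ k % p) g ≈⟨ drop-periods (k / p) ⟩
    Σ< (k % p) g              ∎
    where
    k≡q*p+r : k ≡ k / p *ℕ p +ℕ k % p
    k≡q*p+r = ≡.trans (m≡m%n+[m/n]*n k p) (ℕ.+-comm (k % p) _)
    drop-periods : ∀ q {r} → Σ< (q *ℕ p +ℕ r) g ≈ Σ< r g
    drop-periods zero    = refl
    drop-periods (suc q) {r} = begin
      Σ< (p +ℕ q *ℕ p +ℕ r) g                          ≡⟨ ≡.cong (λ m → Σ< m g) (ℕ.+-assoc p _ r) ⟩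
      Σ< (p +ℕ (q *ℕ p +ℕ r)) g                        ≈⟨ Σ<-+ p _ g ⟩
      Σ< p g + Σ< (q *ℕ p +ℕ r) (λ j → g (p +ℕ j))     ≈⟨ +-cong period≈0 (Σ<-cong (q *ℕ p +ℕ r) (reflexive ∘ periodic)) ⟩
      0# + Σ< (q *ℕ p +ℕ r) g                          ≈⟨ +-identityˡ _ ⟩
      Σ< (q *ℕ p +ℕ r) g                               ≈⟨ drop-periods q ⟩
      Σ< r g                                           ∎

  +-<ᵇ-shift : ∀ i j h → i ≤ h → (i +ℕ j <ᵇ h) ≡ (j <ᵇ h ∸ i)
  +-<ᵇ-shift zero    j h       _         = ≡.refl
  +-<ᵇ-shift (suc i) j (suc h) (s≤s i≤h) = +-<ᵇ-shift i j h i≤h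

  mirror : ∀ h → (ℕ → Carrier) → Vertex h → Carrier
  mirror h f (inj₁ i) = f (toℕ i)
  mirror h f (inj₂ i) = f (toℕ i)

  neighbourhood-sum : ∀ h (i : Fin h) (f : ℕ → Carrier) →
                      Σ< h (λ j → indicator (toℕ i +ℕ j <ᵇ h) * f j) ≈ Σ< (h ∸ toℕ i) f
  neighbourhood-sum h i f = begin
    Σ< h (λ j → indicator (toℕ i +ℕ j <ᵇ h) * f j) ≈⟨ Σ<-cong h (λ j → reflexive (≡.cong (λ b → indicator b * f j) (+-<ᵇ-shift (toℕ i) j h i≤h))) ⟩
    Σ< h (λ j → indicator (j <ᵇ h ∸ toℕ i) * f j)  ≈⟨ Σ<-indicator (ℕ.m∸n≤m h (toℕ i)) f ⟩
    Σ< (h ∸ toℕ i) f                              ∎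
    where i≤h = ℕ.<⇒≤ (toℕ<n i)

  mulVec-mirror-inj₁ : ∀ h (f : ℕ → Carrier) (i : Fin h) →
                       mulVec h (adjMatrix h) (mirror h f) (inj₁ i) ≈ Σ< (h ∸ toℕ i) f
  mulVec-mirror-inj₁ h f i = begin
    mulVec h (adjMatrix h) (mirror h f) (inj₁ i)
      ≡⟨ ≡.cong₂ _+_ (sum≡Σ< h (λ j → 0# * f j)) (sum≡Σ< h (λ j → indicator (toℕ i +ℕ j <ᵇ h) * f j)) ⟩
    Σ< h (λ j → 0# * f j) + Σ< h (λ j → indicator (toℕ i +ℕ j <ᵇ h) * f j)
      ≈⟨ +-cong (Σ<-zero h _ (zeroˡ ∘ f)) (neighbourhood-sum h i f) ⟩
    0# + Σ< (h ∸ toℕ i) f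
      ≈⟨ +-identityˡ _ ⟩
    Σ< (h ∸ toℕ i) f ∎

  mulVec-mirror-inj₂ : ∀ h (f : ℕ → Carrier) (i : Fin h) →
                       mulVec h (adjMatrix h) (mirror h f) (inj₂ i) ≈ Σ< (h ∸ toℕ i) f
  mulVec-mirror-inj₂ h f i = begin
    mulVec h (adjMatrix h) (mirror h f) (inj₂ i)
      ≡⟨ ≡.cong₂ _+_ (sum≡Σ< h (λ j → indicator (j +ℕ toℕ i <ᵇ h) * f j)) (sum≡Σ< h (λ j → 0# * f j)) ⟩
    Σ< h (λ j → indicator (j +ℕ toℕ i <ᵇ h) * f j) + Σ< h (λ j → 0# * f j)
      ≈⟨ +-cong (Σ<-cong h (λ j → reflexive (≡.cong (λ n → indicator (n <ᵇ h) * f j) (ℕ.+-comm j (toℕ i)))))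
                (Σ<-zero h _ (zeroˡ ∘ f)) ⟩
    Σ< h (λ j → indicator (toℕ i +ℕ j <ᵇ h) * f j) + 0#
      ≈⟨ +-identityʳ _ ⟩
    Σ< h (λ j → indicator (toℕ i +ℕ j <ᵇ h) * f j)
      ≈⟨ neighbourhood-sum h i f ⟩
    Σ< (h ∸ toℕ i) f ∎

  -- t + p ∸ r stands for t − r modulo p, kept clear of truncated subtraction.
  relation-from-residues : ∀ p .{{_ : NonZero p}} t {λ′} (f : ℕ → Carrier) (b : Fin p → Carrier) →
                 (∀ k → f k ≈ f (k % p)) →
                 (∀ (r : Fin p) → f (toℕ r) ≈ λ′ * b ((t +ℕ p ∸ toℕ r) mod p)) →
                 ∀ i k → (i +ℕ k) % p ≡ t % p → f k ≈ λ′ * b (i mod p)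
  relation-from-residues p t {λ′} f b f-mod table i k i+k≡t = begin
    f k                             ≈⟨ f-mod k ⟩
    f (k % p)                       ≡⟨ ≡.cong f (toℕ-mod k p) ⟨
    f (toℕ r)                       ≈⟨ table r ⟩
    λ′ * b ((t +ℕ p ∸ toℕ r) mod p) ≡⟨ ≡.cong (λ s → λ′ * b s) (mod-cong _ i p partner) ⟩
    λ′ * b (i mod p)                ∎
    where
    r = k mod p
    partner : (t +ℕ p ∸ toℕ r) % p ≡ i % p
    partner = ≡.trans (≡.cong (λ s → (t +ℕ p ∸ s) % p) (toℕ-mod k p)) ([t+p∸k%p]%p≡i%p i k t p i+k≡t)

  module Root (ω : Carrier) (root : ω * ω + ω - 1# ≈ 0#) where

    x : ℕ → Carrier
    x = xseq ω

    S : ℕ → Carrier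
    S k = Σ< k x

    ω*ω : ω * ω ≈ 1# - ω
    ω*ω = x≈z//y (ω * ω) ω 1# (x∙y⁻¹≈ε⇒x≈y (ω * ω + ω) 1# root)

    ω*-1 : ω * - 1# ≈ - ω
    ω*-1 = trans (sym (-‿distribʳ-* ω 1#)) (-‿cong (*-identityʳ ω))

    ω*-ω : ω * - ω ≈ ω - 1#
    ω*-ω = trans (sym (-‿distribʳ-* ω ω)) (trans (-‿cong ω*ω) (⁻¹-anti-homo‿- 1# ω))

    extend : ∀ n {a b u v} → S n ≈ ω * a → ω * a ≈ u → ω * b ≈ v → u + x n ≈ v → S (suc n) ≈ ω * b
    extend n {a} {b} {u} {v} S≈ωa ωa≈u ωb≈v u+x≈v = begin
      S (suc n)  ≈⟨ Σ<-snoc n x ⟩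
      S n + x n  ≈⟨ +-congʳ (trans S≈ωa ωa≈u) ⟩
      u + x n    ≈⟨ u+x≈v ⟩
      v          ≈⟨ ωb≈v ⟨
      ω * b      ∎

    S₀ : S 0 ≈ ω * 0#
    S₀ = sym (zeroʳ ω)
    S₁ : S 1 ≈ ω * 1#
    S₁ = extend 0 S₀ (zeroʳ ω) (*-identityʳ ω) (+-identityˡ ω)
    S₂ : S 2 ≈ ω * - ω
    S₂ = extend 1 S₁ (*-identityʳ ω) ω*-ω refl
    S₃ : S 3 ≈ ω * - ω
    S₃ = extend 2 S₂ ω*-ω ω*-ω (+-identityʳ _)
    S₄ : S 4 ≈ ω * 1#
    S₄ = extend 3 S₃ ω*-ω (*-identityʳ ω) (//-rightDividesˡ 1# ω)
    S₅ : S 5 ≈ ω * 0#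
    S₅ = extend 4 S₄ (*-identityʳ ω) (zeroʳ ω) (-‿inverseʳ ω)
    S₆ : S 6 ≈ ω * - 1#
    S₆ = extend 5 S₅ (zeroʳ ω) ω*-1 (+-identityˡ _)
    S₇ : S 7 ≈ ω * ω
    S₇ = extend 6 S₆ ω*-1 ω*ω (+-comm (- ω) 1#)
    S₈ : S 8 ≈ ω * ω
    S₈ = extend 7 S₇ ω*ω ω*ω (+-identityʳ _)
    S₉ : S 9 ≈ ω * - 1#
    S₉ = extend 8 S₈ ω*ω ω*-1 (trans (+-congʳ (+-comm 1# (- ω))) (//-rightDividesʳ 1# (- ω)))
    S₁₀ : S 10 ≈ 0#
    S₁₀ = trans (extend 9 S₉ ω*-1 (zeroʳ ω) (-‿inverseˡ ω)) (zeroʳ ω)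

    S≈ω*bseq : ∀ (r : Fin 10) → S (toℕ r) ≈ ω * bseq ω ((7 +ℕ 10 ∸ toℕ r) mod 10)
    S≈ω*bseq 0F = S₀
    S≈ω*bseq 1F = S₁
    S≈ω*bseq 2F = S₂
    S≈ω*bseq 3F = S₃
    S≈ω*bseq 4F = S₄
    S≈ω*bseq 5F = S₅
    S≈ω*bseq 6F = S₆
    S≈ω*bseq 7F = S₇
    S≈ω*bseq 8F = S₈
    S≈ω*bseq 9F = S₉

    S-mod : ∀ k → S k ≈ S (k % 10)
    S-mod = Σ<-periodic 10 x x-periodic S₁₀
      where
      x-periodic : ∀ j → x (10 +ℕ j) ≡ x j
      x-periodic j = ≡.cong (bseq ω) (mod-cong (10 +ℕ j) j 10 (≡.trans (≡.cong (_% 10) (ℕ.+-comm 10 j)) ([m+n]%n≡m%n j 10)))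

    S≈ω*x : ∀ i k → (i +ℕ k) % 10 ≡ 7 → S k ≈ ω * x i
    S≈ω*x = relation-from-residues 10 7 S (bseq ω) S-mod S≈ω*bseq

    bseq-antiperiodic : ∀ (r : Fin 10) → bseq ω ((5 +ℕ toℕ r) mod 10) ≈ - bseq ω r
    bseq-antiperiodic 0F = refl
    bseq-antiperiodic 1F = sym (-‿involutive 1#)
    bseq-antiperiodic 2F = sym -0#≈0#
    bseq-antiperiodic 3F = refl
    bseq-antiperiodic 4F = sym (-‿involutive ω)
    bseq-antiperiodic 5F = sym (-‿involutive ω)
    bseq-antiperiodic 6F = refl
    bseq-antiperiodic 7F = sym -0#≈0#
    bseq-antiperiodic 8F = sym (-‿involutive 1#)
    bseq-antiperiodic 9F = refl

    x-antiperiodic : ∀ i → x (5 +ℕ i) ≈ - x i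
    x-antiperiodic i = begin
      x (5 +ℕ i)                   ≡⟨ ≡.cong (bseq ω) (mod-cong (5 +ℕ i) (5 +ℕ toℕ r) 10 (+-cong-% 5 5 i (toℕ r) 10 ≡.refl i≡r)) ⟩
      bseq ω ((5 +ℕ toℕ r) mod 10) ≈⟨ bseq-antiperiodic r ⟩
      - x i                        ∎
      where
      r = i mod 10
      i≡r : i % 10 ≡ toℕ r % 10
      i≡r = ≡.trans (≡.sym (m%n%n≡m%n i 10)) (≡.cong (_% 10) (≡.sym (toℕ-mod i 10)))

    S≈-ω*x : ∀ i k → (i +ℕ k) % 10 ≡ 2 → S k ≈ - ω * x i
    S≈-ω*x i k i+k≡2 = begin
      S k            ≈⟨ S≈ω*x (5 +ℕ i) k 5+i+k≡7 ⟩
      ω * x (5 +ℕ i) ≈⟨ *-congˡ (x-antiperiodic i) ⟩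
      ω * - x i      ≈⟨ -‿distribʳ-* ω (x i) ⟨
      - (ω * x i)    ≈⟨ -‿distribˡ-* ω (x i) ⟩
      - ω * x i      ∎
      where
      5+i+k≡7 : (5 +ℕ i +ℕ k) % 10 ≡ 7
      5+i+k≡7 = ≡.trans (≡.cong (_% 10) (ℕ.+-assoc 5 i k)) (+-cong-% 5 5 (i +ℕ k) 2 10 ≡.refl i+k≡2)

    ω≉0 : ¬ (1# ≈ 0#) → ¬ (ω ≈ 0#)
    ω≉0 1≉0 ω≈0 = 1≉0 (begin
      1#          ≈⟨ +-identityʳ 1# ⟨
      1# + 0#     ≈⟨ +-congˡ -0#≈0# ⟨
      1# - 0#     ≈⟨ +-congˡ (-‿cong ω≈0) ⟨
      1# - ω      ≈⟨ ω*ω ⟨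
      ω * ω       ≈⟨ *-congʳ ω≈0 ⟩
      0# * ω      ≈⟨ zeroˡ ω ⟩
      0#          ∎)

    eigenvector : ∀ h t {λ′} → ¬ (1# ≈ 0#) → (∀ i k → (i +ℕ k) % 10 ≡ t → S k ≈ λ′ * x i) →
                  suc h % 10 ≡ t → IsEigenvector (suc h) (adjMatrix (suc h)) (yvec (suc h) ω) λ′
    eigenvector h t {λ′} 1≉0 relation h≡t = row , inj₁ 0F , ω≉0 1≉0
      where
      row-sum : ∀ (i : Fin (suc h)) → S (suc h ∸ toℕ i) ≈ λ′ * x (toℕ i)
      row-sum i = relation (toℕ i) (suc h ∸ toℕ i)
        (≡.trans (≡.cong (_% 10) (ℕ.m+[n∸m]≡n (ℕ.<⇒≤ (toℕ<n i)))) h≡t)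
      -- yvec (suc h) ω and mirror (suc h) x agree clause by clause, so the row lemmas apply.
      row : ∀ a → mulVec (suc h) (adjMatrix (suc h)) (yvec (suc h) ω) a ≈ λ′ * yvec (suc h) ω a
      row (inj₁ i) = trans (mulVec-mirror-inj₁ (suc h) x i) (row-sum i)
      row (inj₂ i) = trans (mulVec-mirror-inj₂ (suc h) x i) (row-sum i)

theorem3p8 : {c ℓ : Level} (R : CommutativeRing c ℓ) →
    let open CommutativeRing R in
    let open Over R in
    ¬ (1# ≈ 0#) →
    (ω : Carrier) → ω * ω + ω - 1# ≈ 0# →
    (h : ℕ) →
    (h % 10 ≡ 7 → IsEigenvector h (adjMatrix h) (yvec h ω) ω) ×
    (h % 10 ≡ 2 → IsEigenvector h (adjMatrix h) (yvec h ω) (- ω))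
theorem3p8 R 1≉0 ω root zero    = (λ ()) , (λ ())
theorem3p8 R 1≉0 ω root (suc h) = eigenvector h 7 1≉0 S≈ω*x , eigenvector h 2 1≉0 S≈-ω*x
  where open HalfGraphEigenvector.Root R ω root
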